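{- Let $t$ be a standard tableau of size $n\ge1$ and shape $\lambda$, and let $k\ge0$ with $\mathrm{type}(t)\ge k$. Then $n+2-k+\mathrm{diag}(t/\Delta(t))$ is a positive integer.
   Context: Tableaux use the French convention: row 1 at the bottom, and the box in row $i$, column $j$ has diagonal index $j-i$. In a standard tableau of size $m$, an entry $i$ is an ascent if $i=m$ or $i+1$ is in a row of index at most that of $i$. A derangement tableau is one that is empty or whose smallest ascent is even. Schützenberger's $\Delta$. Delete $1$ from $t$. Slide the empty box by swapping it with the smaller of the entries directly above and directly to the right (among those present), until it reaches an outer corner. Remove it and decrease all entries by $1$; this gives $\Delta(t)$. $t/\Delta(t)$ is the removed box, and $\mathrm{diag}(t/\Delta(t))$ is its diagonal index. $\mathrm{type}(t)$ is the least $j\ge0$ such that $\Delta^j(t)$ is a derangement tableau. -}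

module Defs where

open import Data.Nat using (ℕ; zero; suc; _+_; _<_; _≤_; _<ᵇ_)
open import Data.Nat.Properties using ()
open import Data.Integer using (ℤ; _-_; +_)
open import Data.Bool using (Bool; true; false; if_then_else_)
open import Data.List using (List; []; _∷_; concat; length; map; upTo; sum)
open import Data.List.Relation.Unary.All using (All)
open import Data.List.Relation.Binary.Permutation.Propositional using (_↭_)
open import Data.Maybe using (Maybe; just; nothing)
open import Data.Product using (Σ; _×_; _,_; ∃)
open import Data.Sum using (_⊎_)
open import Data.Nat.Divisibility using (_∣_)
open import Relation.Nullary using (¬_)
open import Relation.Binary.PropositionalEquality using (_≡_; _≢_)

-- A tableau is a list of rows, French convention: the first list is row 1
-- (the bottom row); each row is listed from left (column 1) to right.
-- Internally rows/columns are 0-indexed; diagonal index j - i is unchanged.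
Tableau : Set
Tableau = List (List ℕ)

nth : {A : Set} → List A → ℕ → Maybe A
nth []       _       = nothing
nth (x ∷ xs) zero    = just x
nth (x ∷ xs) (suc k) = nth xs k

entry : Tableau → ℕ → ℕ → Maybe ℕ
entry t i j with nth t i
... | nothing = nothing
... | just r  = nth r j

size : Tableau → ℕ
size t = length (concat t)

-- standard tableau: nonempty rows, rows increase to the right, columns increase
-- upward (which also forces the shape to be a partition), entries are 1..n.
record IsStandard (t : Tableau) : Set where
  field
    rowsNonempty : All (λ r → r ≢ []) t
    rowIncr : ∀ i j b → entry t i (suc j) ≡ just b →
              Σ ℕ λ a → entry t i j ≡ just a × a < b
    colIncr : ∀ i j b → entry t (suc i) j ≡ just b →
              Σ ℕ λ a → entry t i j ≡ just a × a < b
    entries : concat t ↭ map suc (upTo (size t))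

RowOf : Tableau → ℕ → ℕ → Set
RowOf t x i = Σ ℕ λ j → entry t i j ≡ just x

Ascent : Tableau → ℕ → Set
Ascent t x = (1 ≤ x × x ≤ size t) ×
             (x ≡ size t ⊎
              Σ ℕ λ i → Σ ℕ λ i' → RowOf t x i × RowOf t (suc x) i' × i' ≤ i)

IsDerangement : Tableau → Set
IsDerangement t = t ≡ [] ⊎
  Σ ℕ λ x → Ascent t x × 2 ∣ x × (∀ y → y < x → ¬ Ascent t y)

-- Schützenberger's Δ (jeu de taquin), computed directly.

setRow : List ℕ → ℕ → ℕ → List ℕ
setRow []       _       _ = []
setRow (x ∷ xs) zero    v = v ∷ xs
setRow (x ∷ xs) (suc j) v = x ∷ setRow xs j v

set : Tableau → ℕ → ℕ → ℕ → Tableau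
set []       _       _ _ = []
set (r ∷ rs) zero    j v = setRow r j v ∷ rs
set (r ∷ rs) (suc i) j v = r ∷ set rs i j v

dropLast : List ℕ → List ℕ
dropLast []           = []
dropLast (x ∷ [])     = []
dropLast (x ∷ y ∷ xs) = x ∷ dropLast (y ∷ xs)

removeLast : Tableau → ℕ → Tableau
removeLast []       _       = []
removeLast (r ∷ rs) zero    with dropLast r
... | []      = rs
... | (x ∷ xs) = (x ∷ xs) ∷ rs
removeLast (r ∷ rs) (suc i) = r ∷ removeLast rs i

-- slide the empty box at (i,j); returns the tableau (hole position holds a
-- stale value) and the final position of the empty box (an outer corner).
-- The fuel `size t` suffices: each step increases i + j by one.
slide : ℕ → Tableau → ℕ → ℕ → Tableau × (ℕ × ℕ)
slide zero    t i j = t , (i , j)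
slide (suc f) t i j with entry t (suc i) j | entry t i (suc j)
... | nothing | nothing = t , (i , j)
... | just a  | nothing = slide f (set t i j a) (suc i) j
... | nothing | just b  = slide f (set t i j b) i (suc j)
... | just a  | just b  = if a <ᵇ b then slide f (set t i j a) (suc i) j
                                    else slide f (set t i j b) i (suc j)

decr : Tableau → Tableau
decr = map (map Data.Nat.pred)

-- the hole starts at (0,0), the box of 1 in a standard tableau
slideResult : Tableau → Tableau × (ℕ × ℕ)
slideResult t = slide (size t) t 0 0

Δ : Tableau → Tableau
Δ t with slideResult t
... | (t' , (i , j)) = decr (removeLast t' i)

-- diagonal index (column - row) of the box t/Δ(t)
diagRemoved : Tableau → ℤ
diagRemoved t with slideResult t
... | (_ , (i , j)) = + j - + i

iter : ℕ → (Tableau → Tableau) → Tableau → Tableau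
iter zero    f t = t
iter (suc k) f t = f (iter k f t)

IsType : Tableau → ℕ → Set
IsType t j = IsDerangement (iter j Δ t) × (∀ i → i < j → ¬ IsDerangement (iter i Δ t))

module Submission where

-- Write (i , j) for the (0-based) box t/Δ(t), so diag(t/Δ(t)) = j - i, and let
-- the bottom row of t begin with 1, 2, …, r+1 but not with r+2 in the next box.
-- The proof consists of two inequalities:
--   (A)  type(t) ≤ r + 1, and
--   (B)  (r + 1) + i ≤ n,
-- since the bottom row has at least r+1 boxes and each of the rows 1 … i
-- (which exist, t/Δ(t) lying in row i) has at least one more.  Then
-- k + i ≤ n < n + 2 + j, which is the claim.
--
-- If r = 0, either Δ(t) = [] or the
--     first column run of t or of Δ(t) has even length.  If r > 0, the bottom
--     row run of Δ(t) is exactly one shorter than that of t.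

module Development where

  open import Defs
  open import Data.Nat
  open import Data.Nat.Properties
  open import Data.Nat.Divisibility using (_∣_; divides)
  open import Data.Bool using (true; false; T)
  open import Data.List using (List; []; _∷_; _++_; [_]; concat; length; map; upTo)
  import Data.List.Properties as List
  open import Data.List.Relation.Binary.Permutation.Propositional
    using (_↭_; refl; prep; swap; ↭-sym; ↭-trans) renaming (trans to ↭-step)
  open import Data.List.Relation.Binary.Permutation.Propositional.Properties using (shift; ↭-length)
  open import Data.List.Relation.Unary.All using (All; []; _∷_)
  open import Data.Maybe using (Maybe; just; nothing)
  import Data.Maybe as Maybe
  import Data.Maybe.Properties as Maybe
  open import Data.Product using (Σ; _×_; _,_; proj₁; proj₂)
  open import Data.Sum using (_⊎_; inj₁; inj₂)
  open import Data.Empty using (⊥; ⊥-elim)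
  import Data.Integer as ℤ
  import Data.Integer.Properties as ℤ
  open import Data.Integer.Tactic.RingSolver using (solve-∀)
  open import Relation.Nullary using (¬_; Dec; yes; no)
  open import Relation.Binary using (tri<; tri≈; tri>)
  open import Relation.Binary.PropositionalEquality hiding ([_])
  open import Algebra.Properties.CommutativeSemigroup +-commutativeSemigroup
    using () renaming (xy∙z≈xz∙y to +-swapʳ)
  open import Function using (_∘′_)

  δ : ℕ → ℕ → ℕ
  δ x y with x ≟ y
  ... | yes _ = 1
  ... | no _  = 0

  δ-refl : ∀ x → δ x x ≡ 1
  δ-refl x with x ≟ x
  ... | yes _ = refl
  ... | no x≢x = ⊥-elim (x≢x refl)

  δ-≢ : ∀ {x y} → x ≢ y → δ x y ≡ 0
  δ-≢ {x} {y} x≢y with x ≟ y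
  ... | yes x≡y = ⊥-elim (x≢y x≡y)
  ... | no _    = refl

  δ-suc : ∀ x y → δ (suc x) (suc y) ≡ δ x y
  δ-suc x y with x ≟ y | suc x ≟ suc y
  ... | yes _   | yes _   = refl
  ... | no _    | no _    = refl
  ... | yes x≡y | no sx≢sy = ⊥-elim (sx≢sy (cong suc x≡y))
  ... | no x≢y  | yes sx≡sy = ⊥-elim (x≢y (suc-injective sx≡sy))

  cnt : ℕ → List ℕ → ℕ
  cnt x []       = 0
  cnt x (y ∷ ys) = δ x y + cnt x ys

  cnt-++ : ∀ x xs ys → cnt x (xs ++ ys) ≡ cnt x xs + cnt x ys
  cnt-++ x []       ys = refl
  cnt-++ x (y ∷ xs) ys = trans (cong (δ x y +_) (cnt-++ x xs ys)) (sym (+-assoc (δ x y) _ _))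

  cnt-↭ : ∀ x {xs ys} → xs ↭ ys → cnt x xs ≡ cnt x ys
  cnt-↭ x refl           = refl
  cnt-↭ x (prep y p)     = cong (δ x y +_) (cnt-↭ x p)
  cnt-↭ x (swap {xs} {ys} y z p) = begin
      δ x y + (δ x z + cnt x xs)  ≡⟨ cong (λ c → δ x y + (δ x z + c)) (cnt-↭ x p) ⟩
      δ x y + (δ x z + cnt x ys)  ≡⟨ sym (+-assoc (δ x y) _ _) ⟩
      δ x y + δ x z + cnt x ys    ≡⟨ cong (_+ cnt x ys) (+-comm (δ x y) (δ x z)) ⟩
      δ x z + δ x y + cnt x ys    ≡⟨ +-assoc (δ x z) _ _ ⟩
      δ x z + (δ x y + cnt x ys)  ∎
    where open ≡-Reasoning
  cnt-↭ x (↭-step p q)   = trans (cnt-↭ x p) (cnt-↭ x q)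

  cnt-split : ∀ x ys → 1 ≤ cnt x ys → Σ (List ℕ) λ L → Σ (List ℕ) λ M → ys ≡ L ++ x ∷ M
  cnt-split x []       ()
  cnt-split x (y ∷ ys) p with x ≟ y
  ... | yes refl = [] , ys , refl
  ... | no _ with cnt-split x ys p
  ...   | L , M , ys≡ = y ∷ L , M , cong (y ∷_) ys≡

  cnt⇒↭ : ∀ xs ys → (∀ x → cnt x xs ≡ cnt x ys) → xs ↭ ys
  cnt⇒↭ []       []       same = refl
  cnt⇒↭ []       (y ∷ ys) same with trans (same y) (cong (_+ cnt y ys) (δ-refl y))
  ... | ()
  cnt⇒↭ (x ∷ xs) ys same
    with cnt-split x ys (subst (1 ≤_) (trans (cong (_+ cnt x xs) (sym (δ-refl x))) (same x)) (s≤s z≤n))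
  ... | L , M , refl = ↭-trans (prep x (cnt⇒↭ xs (L ++ M) same′)) (↭-sym (shift x L M))
    where
    same′ : ∀ z → cnt z xs ≡ cnt z (L ++ M)
    same′ z = +-cancelˡ-≡ (δ z x) _ _ (trans (same z) (cnt-↭ z (shift x L M)))

  -- Indicator of the interval 1 … n: the multiplicities of a standard tableau.
  ind : ℕ → ℕ → ℕ
  ind n zero = 0
  ind n (suc x) with suc x ≤? n
  ... | yes _ = 1
  ... | no _  = 0

  ind-in : ∀ {n x} → 1 ≤ x → x ≤ n → ind n x ≡ 1
  ind-in {n} {suc x} _ x≤n with suc x ≤? n
  ... | yes _   = refl
  ... | no x≰n  = ⊥-elim (x≰n x≤n)

  ind-pos : ∀ {n x} → 1 ≤ ind n x → 1 ≤ x × x ≤ n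
  ind-pos {n} {suc x} p with suc x ≤? n
  ... | yes x≤n = s≤s z≤n , x≤n

  ind≤1 : ∀ n x → ind n x ≤ 1
  ind≤1 n zero = z≤n
  ind≤1 n (suc x) with suc x ≤? n
  ... | yes _ = s≤s z≤n
  ... | no _  = z≤n

  ind-suc : ∀ n x → ind (suc n) x ≡ ind n x + δ x (suc n)
  ind-suc n zero = refl
  ind-suc n (suc x) with suc x ≤? suc n | suc x ≤? n | suc x ≟ suc n
  ... | yes _   | yes x<n | yes refl = ⊥-elim (<-irrefl refl x<n)
  ... | yes _   | yes _   | no _     = refl
  ... | yes _   | no _    | yes _    = refl
  ... | yes x≤n | no x≰n  | no x≢n  = ⊥-elim (x≢n (≤-antisym x≤n (≰⇒> x≰n)))
  ... | no x≰n  | yes x<n | _        = ⊥-elim (x≰n (m≤n⇒m≤1+n x<n))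
  ... | no x≰n  | no _    | yes refl = ⊥-elim (x≰n ≤-refl)
  ... | no _    | no _    | no _     = refl

  -- Removing the value 1 and renumbering x + 1 ↦ x turns 1 … n into 1 … n - 1.
  ind-shift : ∀ n x → 1 ≤ n → ind n (suc x) ≡ δ (suc x) 1 + ind (n ∸ 1) x
  ind-shift (suc m) zero    _ = ind-in {suc m} {1} ≤-refl (s≤s z≤n)
  ind-shift (suc m) (suc y) _ with suc (suc y) ≤? suc m | suc y ≤? m
  ... | yes _         | yes _  = refl
  ... | no _          | no _   = refl
  ... | yes (s≤s y<m) | no y≮m = ⊥-elim (y≮m y<m)
  ... | no y≮m        | yes y<m = ⊥-elim (y≮m (s≤s y<m))

  cnt-upTo : ∀ x n → cnt x (map suc (upTo n)) ≡ ind n x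
  cnt-upTo x zero with x
  ... | zero  = refl
  ... | suc _ = refl
  cnt-upTo x (suc n) = begin
      cnt x (map suc (upTo (suc n)))           ≡⟨ cong (cnt x ∘′ map suc) (sym (List.upTo-∷ʳ n)) ⟩
      cnt x (map suc (upTo n ++ [ n ]))        ≡⟨ cong (cnt x) (List.map-++ suc (upTo n) [ n ]) ⟩
      cnt x (map suc (upTo n) ++ [ suc n ])    ≡⟨ cnt-++ x (map suc (upTo n)) [ suc n ] ⟩
      cnt x (map suc (upTo n)) + (δ x (suc n) + 0) ≡⟨ cong₂ _+_ (cnt-upTo x n) (+-identityʳ _) ⟩
      ind n x + δ x (suc n)                    ≡⟨ sym (ind-suc n x) ⟩
      ind (suc n) x                            ∎
    where open ≡-Reasoning

  nothing≢just : ∀ {A : Set} {x : A} → nothing ≢ just x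
  nothing≢just ()

  _≢ᶜ_ : ℕ × ℕ → ℕ × ℕ → Set
  (a , b) ≢ᶜ (i , j) = ¬ (a ≡ i × b ≡ j)

  RowsNonempty : Tableau → Set
  RowsNonempty = All (λ r → r ≢ [])

  nth-setRow-eq : ∀ r j v → nth (setRow r j v) j ≡ Maybe.map (λ _ → v) (nth r j)
  nth-setRow-eq []      j       v = refl
  nth-setRow-eq (x ∷ r) zero    v = refl
  nth-setRow-eq (x ∷ r) (suc j) v = nth-setRow-eq r j v

  nth-setRow-ne : ∀ r j v b → b ≢ j → nth (setRow r j v) b ≡ nth r b
  nth-setRow-ne []      j       v b       _   = refl
  nth-setRow-ne (x ∷ r) zero    v zero    b≢j = ⊥-elim (b≢j refl)
  nth-setRow-ne (x ∷ r) zero    v (suc b) _   = refl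
  nth-setRow-ne (x ∷ r) (suc j) v zero    _   = refl
  nth-setRow-ne (x ∷ r) (suc j) v (suc b) b≢j = nth-setRow-ne r j v b (b≢j ∘′ cong suc)

  cnt-setRow : ∀ x r j v w → nth r j ≡ just w → cnt x (setRow r j v) + δ x w ≡ cnt x r + δ x v
  cnt-setRow x (y ∷ r) zero    v w refl = begin
      δ x v + cnt x r + δ x y   ≡⟨ +-swapʳ (δ x v) _ _ ⟩
      δ x v + δ x y + cnt x r   ≡⟨ cong (_+ cnt x r) (+-comm (δ x v) (δ x y)) ⟩
      δ x y + δ x v + cnt x r   ≡⟨ +-swapʳ (δ x y) _ _ ⟩
      δ x y + cnt x r + δ x v   ∎
    where open ≡-Reasoning
  cnt-setRow x (y ∷ r) (suc j) v w e =
    trans (+-assoc (δ x y) _ _) (trans (cong (δ x y +_) (cnt-setRow x r j v w e)) (sym (+-assoc (δ x y) _ _)))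

  nth-one : ∀ x r b → nth r b ≡ just x → 1 ≤ cnt x r
  nth-one x (y ∷ r) zero    refl = ≤-trans (≤-reflexive (sym (δ-refl x))) (m≤m+n _ _)
  nth-one x (y ∷ r) (suc b) e    = ≤-trans (nth-one x r b e) (m≤n+m _ (δ x y))

  nth-two : ∀ x r b d → nth r b ≡ just x → nth r d ≡ just x → b ≢ d → 2 ≤ cnt x r
  nth-two x (y ∷ r) zero    zero    _    _    b≢d = ⊥-elim (b≢d refl)
  nth-two x (y ∷ r) zero    (suc d) refl e₂   _   rewrite δ-refl x = s≤s (nth-one x r d e₂)
  nth-two x (y ∷ r) (suc b) zero    e₁   refl _   rewrite δ-refl x = s≤s (nth-one x r b e₁)
  nth-two x (y ∷ r) (suc b) (suc d) e₁   e₂   b≢d =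
    ≤-trans (nth-two x r b d e₁ e₂ (b≢d ∘′ cong suc)) (m≤n+m _ (δ x y))

  nth-locate : ∀ x r → 1 ≤ cnt x r → Σ ℕ λ b → nth r b ≡ just x
  nth-locate x (y ∷ r) p with x ≟ y
  ... | yes refl = 0 , refl
  ... | no _ with nth-locate x r p
  ...   | b , e = suc b , e

  nth-length : ∀ {x : ℕ} (r : List ℕ) b → nth r b ≡ just x → b < length r
  nth-length (y ∷ r) zero    e = s≤s z≤n
  nth-length (y ∷ r) (suc b) e = s≤s (nth-length r b e)

  nth-map : ∀ (f : ℕ → ℕ) r b → nth (map f r) b ≡ Maybe.map f (nth r b)
  nth-map f []      b       = refl
  nth-map f (x ∷ r) zero    = refl
  nth-map f (x ∷ r) (suc b) = nth-map f r b

  dropLast-nth : ∀ r j w → nth r j ≡ just w → nth r (suc j) ≡ nothing →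
    (∀ b → b ≢ j → nth (dropLast r) b ≡ nth r b) × nth (dropLast r) j ≡ nothing
  dropLast-nth (x ∷ [])    zero    w e₁ e₂ = (λ { zero b≢0 → ⊥-elim (b≢0 refl) ; (suc b) _ → refl }) , refl
  dropLast-nth (x ∷ y ∷ r) (suc j) w e₁ e₂ with dropLast-nth (y ∷ r) j w e₁ e₂
  ... | others , last = (λ { zero _ → refl ; (suc b) b≢j → others b (b≢j ∘′ cong suc) }) , last

  dropLast-cnt : ∀ x r j w → nth r j ≡ just w → nth r (suc j) ≡ nothing → cnt x (dropLast r) + δ x w ≡ cnt x r
  dropLast-cnt x (y ∷ [])    zero    w refl _ = +-comm 0 (δ x w)
  dropLast-cnt x (y ∷ z ∷ r) (suc j) w e₁   e₂ =
    trans (+-assoc (δ x y) _ _) (cong (δ x y +_) (dropLast-cnt x (z ∷ r) j w e₁ e₂))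

  dropLast-empty : ∀ r j w → nth r j ≡ just w → dropLast r ≡ [] → j ≡ 0
  dropLast-empty (x ∷ [])    zero    w _ _ = refl
  dropLast-empty (x ∷ y ∷ r) j       w _ ()

  set-eq : ∀ u i j v → entry (set u i j v) i j ≡ Maybe.map (λ _ → v) (entry u i j)
  set-eq []      i       j v = refl
  set-eq (r ∷ u) zero    j v = nth-setRow-eq r j v
  set-eq (r ∷ u) (suc i) j v = set-eq u i j v

  set-ne : ∀ u i j v a b → (a , b) ≢ᶜ (i , j) → entry (set u i j v) a b ≡ entry u a b
  set-ne []      i       j v a       b _  = refl
  set-ne (r ∷ u) zero    j v zero    b ne = nth-setRow-ne r j v b (λ e → ne (refl , e))
  set-ne (r ∷ u) zero    j v (suc a) b _  = refl
  set-ne (r ∷ u) (suc i) j v zero    b _  = refl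
  set-ne (r ∷ u) (suc i) j v (suc a) b ne = set-ne u i j v a b (λ { (e , e′) → ne (cong suc e , e′) })

  set-just : ∀ u i j v w → entry u i j ≡ just w → entry (set u i j v) i j ≡ just v
  set-just u i j v w e = trans (set-eq u i j v) (cong (Maybe.map (λ _ → v)) e)

  set-nothing : ∀ u i j v a b → entry (set u i j v) a b ≡ nothing → entry u a b ≡ nothing
  set-nothing u i j v a b e with a ≟ i | b ≟ j
  ... | no a≢i   | _        = trans (sym (set-ne u i j v a b (a≢i ∘′ proj₁))) e
  ... | yes _    | no b≢j   = trans (sym (set-ne u i j v a b (b≢j ∘′ proj₂))) e
  ... | yes refl | yes refl with entry u a b | set-eq u a b v
  ...   | nothing | _   = refl
  ...   | just _  | eqn = ⊥-elim (nothing≢just (trans (sym e) eqn))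

  set-nothing′ : ∀ u i j v a b → entry u a b ≡ nothing → entry (set u i j v) a b ≡ nothing
  set-nothing′ u i j v a b e with a ≟ i | b ≟ j
  ... | no a≢i   | _        = trans (set-ne u i j v a b (a≢i ∘′ proj₁)) e
  ... | yes _    | no b≢j   = trans (set-ne u i j v a b (b≢j ∘′ proj₂)) e
  ... | yes refl | yes refl = trans (set-eq u a b v) (cong (Maybe.map (λ _ → v)) e)

  set-rowsNonempty : ∀ u i j v → RowsNonempty u → RowsNonempty (set u i j v)
  set-rowsNonempty []      i       j v ne       = ne
  set-rowsNonempty (r ∷ u) (suc i) j v (p ∷ ne) = p ∷ set-rowsNonempty u i j v ne
  set-rowsNonempty ((x ∷ r) ∷ u) zero zero    v (_ ∷ ne) = (λ ()) ∷ ne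
  set-rowsNonempty ((x ∷ r) ∷ u) zero (suc j) v (_ ∷ ne) = (λ ()) ∷ ne
  set-rowsNonempty ([] ∷ u)      zero j       v (p ∷ ne) = ⊥-elim (p refl)

  cnt-set : ∀ x u i j v w → entry u i j ≡ just w → cnt x (concat (set u i j v)) + δ x w ≡ cnt x (concat u) + δ x v
  cnt-set x (r ∷ u) zero j v w e
    rewrite cnt-++ x (setRow r j v) (concat u) | cnt-++ x r (concat u) = begin
      cnt x (setRow r j v) + cnt x (concat u) + δ x w   ≡⟨ +-swapʳ (cnt x (setRow r j v)) _ _ ⟩
      cnt x (setRow r j v) + δ x w + cnt x (concat u)   ≡⟨ cong (_+ cnt x (concat u)) (cnt-setRow x r j v w e) ⟩
      cnt x r + δ x v + cnt x (concat u)                ≡⟨ +-swapʳ (cnt x r) _ _ ⟩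
      cnt x r + cnt x (concat u) + δ x v                ∎
    where open ≡-Reasoning
  cnt-set x (r ∷ u) (suc i) j v w e
    rewrite cnt-++ x r (concat (set u i j v)) | cnt-++ x r (concat u) = begin
      cnt x r + cnt x (concat (set u i j v)) + δ x w    ≡⟨ +-assoc (cnt x r) _ _ ⟩
      cnt x r + (cnt x (concat (set u i j v)) + δ x w)  ≡⟨ cong (cnt x r +_) (cnt-set x u i j v w e) ⟩
      cnt x r + (cnt x (concat u) + δ x v)              ≡⟨ sym (+-assoc (cnt x r) _ _) ⟩
      cnt x r + cnt x (concat u) + δ x v                ∎
    where open ≡-Reasoning

  one-cell : ∀ x u a b → entry u a b ≡ just x → 1 ≤ cnt x (concat u)
  one-cell x (r ∷ u) zero    b e rewrite cnt-++ x r (concat u) = ≤-trans (nth-one x r b e) (m≤m+n _ _)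
  one-cell x (r ∷ u) (suc a) b e rewrite cnt-++ x r (concat u) = ≤-trans (one-cell x u a b e) (m≤n+m _ _)

  two-cells : ∀ x u a b c d → entry u a b ≡ just x → entry u c d ≡ just x → (a , b) ≢ᶜ (c , d) →
              2 ≤ cnt x (concat u)
  two-cells x (r ∷ u) zero b zero d e₁ e₂ ne rewrite cnt-++ x r (concat u) =
    ≤-trans (nth-two x r b d e₁ e₂ (λ e → ne (refl , e))) (m≤m+n _ _)
  two-cells x (r ∷ u) zero b (suc c) d e₁ e₂ _ rewrite cnt-++ x r (concat u) =
    +-mono-≤ (nth-one x r b e₁) (one-cell x u c d e₂)
  two-cells x (r ∷ u) (suc a) b zero d e₁ e₂ _ rewrite cnt-++ x r (concat u) =
    subst (2 ≤_) (+-comm (cnt x (concat u)) (cnt x r)) (+-mono-≤ (one-cell x u a b e₁) (nth-one x r d e₂))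
  two-cells x (r ∷ u) (suc a) b (suc c) d e₁ e₂ ne rewrite cnt-++ x r (concat u) =
    ≤-trans (two-cells x u a b c d e₁ e₂ (λ { (e , e′) → ne (cong suc e , e′) })) (m≤n+m _ _)

  locate : ∀ x u → 1 ≤ cnt x (concat u) → Σ ℕ λ a → Σ ℕ λ b → entry u a b ≡ just x
  locate x (r ∷ u) p with cnt x r | cnt-++ x r (concat u) | nth-locate x r
  ... | zero  | split | _ with locate x u (subst (1 ≤_) split p)
  ...   | a , b , e = suc a , b , e
  locate x (r ∷ u) p | suc _ | _ | inRow with inRow (s≤s z≤n)
  ... | b , e = 0 , b , e

  -- Sizes: a box (a , b) has at least a + b boxes before it (one in each lower
  -- row and b to its left), and likewise for a box of row i together with a
  -- box in column r of the bottom row.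
  size-cons : ∀ r u → size (r ∷ u) ≡ length r + size u
  size-cons r u = List.length-++ r

  1≤length : ∀ (r : List ℕ) → r ≢ [] → 1 ≤ length r
  1≤length []      r≢[] = ⊥-elim (r≢[] refl)
  1≤length (x ∷ r) _    = s≤s z≤n

  cell-size : ∀ {x : ℕ} u a b → RowsNonempty u → entry u a b ≡ just x → a + b < size u
  cell-size (r ∷ u) zero    b _        e rewrite size-cons r u = ≤-trans (nth-length r b e) (m≤m+n _ _)
  cell-size (r ∷ u) (suc a) b (p ∷ ne) e rewrite size-cons r u = +-mono-≤ (1≤length r p) (cell-size u a b ne e)

  bottomRow-size : ∀ {x y : ℕ} u r i j → RowsNonempty u → entry u 0 r ≡ just x → entry u i j ≡ just y →
                   r + 1 + i ≤ size u
  bottomRow-size (row ∷ u) r zero j _ e₁ _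
    rewrite size-cons row u | +-identityʳ (r + 1) | +-comm r 1 = ≤-trans (nth-length row r e₁) (m≤m+n _ _)
  bottomRow-size (row ∷ u) r (suc i) j (_ ∷ ne) e₁ e₂ rewrite size-cons row u =
    subst (λ z → z + suc i ≤ length row + size u) (+-comm 1 r)
      (+-mono-≤ (nth-length row r e₁) (≤-trans (s≤s (m≤m+n i j)) (cell-size u i j ne e₂)))

  -- A nonempty row above row i would start in column 0, so when row i is the
  -- single box (i , 0) the hypothesis on (i + 1 , j) says there is no such row.
  OuterCorner : Tableau → ℕ → ℕ → ℕ → Set
  OuterCorner u i j w = entry u i j ≡ just w × entry u i (suc j) ≡ nothing × entry u (suc i) j ≡ nothing

  private
    rowAbove-absent : ∀ (r : List ℕ) → r ≢ [] → nth r 0 ≡ nothing → ⊥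
    rowAbove-absent []      r≢[] _  = r≢[] refl
    rowAbove-absent (_ ∷ _) _    ()

  removeLast-others : ∀ u i j w → RowsNonempty u → OuterCorner u i j w →
                      ∀ a b → (a , b) ≢ᶜ (i , j) → entry (removeLast u i) a b ≡ entry u a b
  removeLast-others (r ∷ rs) zero j w (_ ∷ ne) (e₁ , e₂ , e₃) a b a≢
    with dropLast r | dropLast-nth r j w e₁ e₂ | dropLast-empty r j w e₁
  removeLast-others (r ∷ []) zero j w _ _ zero b a≢ | [] | same , _ | j≡0 rewrite j≡0 refl = same b (λ e → a≢ (refl , e))
  removeLast-others (r ∷ []) zero j w _ _ (suc a) b _ | [] | _ | _ = refl
  removeLast-others (r ∷ r′ ∷ rs) zero j w (_ ∷ p′ ∷ _) (_ , _ , e₃) _ _ _ | [] | _ | j≡0 rewrite j≡0 refl =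
    ⊥-elim (rowAbove-absent r′ p′ e₃)
  removeLast-others (r ∷ rs) zero j w _ _ zero b a≢ | _ ∷ _ | same , _ | _ = same b (λ e → a≢ (refl , e))
  removeLast-others (r ∷ rs) zero j w _ _ (suc a) b _ | _ ∷ _ | _ | _ = refl
  removeLast-others (r ∷ rs) (suc i) j w _ _ zero b _ = refl
  removeLast-others (r ∷ rs) (suc i) j w (_ ∷ ne) c (suc a) b a≢ =
    removeLast-others rs i j w ne c a b (λ { (e , e′) → a≢ (cong suc e , e′) })

  removeLast-corner : ∀ u i j w → RowsNonempty u → OuterCorner u i j w → entry (removeLast u i) i j ≡ nothing
  removeLast-corner (r ∷ rs) zero j w (_ ∷ ne) (e₁ , e₂ , e₃)
    with dropLast r | dropLast-nth r j w e₁ e₂ | dropLast-empty r j w e₁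
  removeLast-corner (r ∷ []) zero j w _ _ | [] | _ | _ = refl
  removeLast-corner (r ∷ r′ ∷ rs) zero j w (_ ∷ p′ ∷ _) (_ , _ , e₃) | [] | _ | j≡0 rewrite j≡0 refl =
    ⊥-elim (rowAbove-absent r′ p′ e₃)
  removeLast-corner (r ∷ rs) zero j w _ _ | _ ∷ _ | _ , gone | _ = gone
  removeLast-corner (r ∷ rs) (suc i) j w (_ ∷ ne) c = removeLast-corner rs i j w ne c

  removeLast-cnt : ∀ x u i j w → entry u i j ≡ just w → entry u i (suc j) ≡ nothing →
                   cnt x (concat (removeLast u i)) + δ x w ≡ cnt x (concat u)
  removeLast-cnt x (r ∷ rs) zero j w e₁ e₂ rewrite cnt-++ x r (concat rs) with dropLast r | dropLast-cnt x r j w e₁ e₂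
  ... | []     | c = trans (+-comm (cnt x (concat rs)) (δ x w)) (cong (_+ cnt x (concat rs)) c)
  ... | y ∷ ys | c rewrite cnt-++ x (y ∷ ys) (concat rs) = begin
      cnt x (y ∷ ys) + cnt x (concat rs) + δ x w    ≡⟨ +-swapʳ (cnt x (y ∷ ys)) _ _ ⟩
      cnt x (y ∷ ys) + δ x w + cnt x (concat rs)    ≡⟨ cong (_+ cnt x (concat rs)) c ⟩
      cnt x r + cnt x (concat rs)                   ∎
    where open ≡-Reasoning
  removeLast-cnt x (r ∷ rs) (suc i) j w e₁ e₂ rewrite cnt-++ x r (concat rs) | cnt-++ x r (concat (removeLast rs i)) =
    trans (+-assoc (cnt x r) _ _) (cong (cnt x r +_) (removeLast-cnt x rs i j w e₁ e₂))

  removeLast-rowsNonempty : ∀ u i → RowsNonempty u → RowsNonempty (removeLast u i)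
  removeLast-rowsNonempty []       i       ne = ne
  removeLast-rowsNonempty (r ∷ rs) zero    (p ∷ ne) with dropLast r
  ... | []     = ne
  ... | _ ∷ _  = (λ ()) ∷ ne
  removeLast-rowsNonempty (r ∷ rs) (suc i) (p ∷ ne) = p ∷ removeLast-rowsNonempty rs i ne

  decr-entry : ∀ u a b → entry (decr u) a b ≡ Maybe.map pred (entry u a b)
  decr-entry []      a       b = refl
  decr-entry (r ∷ u) zero    b = nth-map pred r b
  decr-entry (r ∷ u) (suc a) b = decr-entry u a b

  decr-rowsNonempty : ∀ u → RowsNonempty u → RowsNonempty (decr u)
  decr-rowsNonempty []            ne       = ne
  decr-rowsNonempty ([] ∷ u)      (p ∷ _)  = ⊥-elim (p refl)
  decr-rowsNonempty ((x ∷ r) ∷ u) (_ ∷ ne) = (λ ()) ∷ decr-rowsNonempty u ne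

  cnt-map-pred : ∀ x xs → cnt 0 xs ≡ 0 → cnt x (map pred xs) ≡ cnt (suc x) xs
  cnt-map-pred x []           _  = refl
  cnt-map-pred x (zero ∷ xs)  no0 rewrite δ-refl 0 with no0
  ... | ()
  cnt-map-pred x (suc y ∷ xs) no0 = cong₂ _+_ (sym (δ-suc x y)) (cnt-map-pred x xs no0)

  cnt-decr : ∀ x u → cnt 0 (concat u) ≡ 0 → cnt x (concat (decr u)) ≡ cnt (suc x) (concat u)
  cnt-decr x u no0 rewrite List.concat-map {f = pred} u = cnt-map-pred x (concat u) no0

  module Standard {t : Tableau} (S : IsStandard t) where
    open IsStandard S public

    n : ℕ
    n = size t

    multiplicity : ∀ x → cnt x (concat t) ≡ ind n x
    multiplicity x = trans (cnt-↭ x entries) (cnt-upTo x n)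

    range : ∀ {a b x} → entry t a b ≡ just x → 1 ≤ x × x ≤ n
    range {a} {b} {x} e = ind-pos (subst (1 ≤_) (multiplicity x) (one-cell x t a b e))

    notTwice : ∀ {a b c d x} → entry t a b ≡ just x → entry t c d ≡ just x → ¬ (a , b) ≢ᶜ (c , d)
    notTwice {a} {b} {c} {d} {x} e₁ e₂ ne
      with ≤-trans (two-cells x t a b c d e₁ e₂ ne) (≤-trans (≤-reflexive (multiplicity x)) (ind≤1 n x))
    ... | s≤s ()

    distinct : ∀ {a b c d x} → entry t a b ≡ just x → entry t c d ≡ just x → a ≡ c × b ≡ d
    distinct {a} {b} {c} {d} e₁ e₂ with a ≟ c | b ≟ d
    ... | yes a≡c | yes b≡d = a≡c , b≡d
    ... | no a≢c  | _       = ⊥-elim (notTwice e₁ e₂ (a≢c ∘′ proj₁))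
    ... | yes _   | no b≢d  = ⊥-elim (notTwice e₁ e₂ (b≢d ∘′ proj₂))

    position : ∀ x → 1 ≤ x → x ≤ n → Σ ℕ λ a → Σ ℕ λ b → entry t a b ≡ just x
    position x 1≤x x≤n = locate x t (subst (1 ≤_) (sym (multiplicity x)) (≤-reflexive (sym (ind-in 1≤x x≤n))))

    rowStep : ∀ i j x y → entry t i j ≡ just x → entry t i (suc j) ≡ just y → x < y
    rowStep i j x y e₁ e₂ with rowIncr i j y e₂
    ... | _ , e , lt rewrite Maybe.just-injective (trans (sym e₁) e) = lt

    colStep : ∀ i j x y → entry t i j ≡ just x → entry t (suc i) j ≡ just y → x < y
    colStep i j x y e₁ e₂ with colIncr i j y e₂
    ... | _ , e , lt rewrite Maybe.just-injective (trans (sym e₁) e) = lt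

    colMono : ∀ d a b x → entry t (a + d) b ≡ just x → Σ ℕ λ y → entry t a b ≡ just y × y + d ≤ x
    colMono zero    a b x e = x , subst (λ k → entry t k b ≡ just x) (+-identityʳ a) e , ≤-reflexive (+-identityʳ x)
    colMono (suc d) a b x e with colIncr (a + d) b x (subst (λ k → entry t k b ≡ just x) (+-suc a d) e)
    ... | z , ez , z<x with colMono d a b z ez
    ...   | y , ey , y+d≤z = y , ey , subst (_≤ x) (sym (+-suc y d)) (≤-trans (s≤s y+d≤z) z<x)

    rowMono : ∀ d a b x → entry t a (b + d) ≡ just x → Σ ℕ λ y → entry t a b ≡ just y × y + d ≤ x
    rowMono zero    a b x e = x , subst (λ k → entry t a k ≡ just x) (+-identityʳ b) e , ≤-reflexive (+-identityʳ x)
    rowMono (suc d) a b x e with rowIncr a (b + d) x (subst (λ k → entry t a k ≡ just x) (+-suc b d) e)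
    ... | z , ez , z<x with rowMono d a b z ez
    ...   | y , ey , y+d≤z = y , ey , subst (_≤ x) (sym (+-suc y d)) (≤-trans (s≤s y+d≤z) z<x)

    a+b<entry : ∀ {a b x} → entry t a b ≡ just x → a + b < x
    a+b<entry {a} {b} {x} e with colMono a 0 b x e
    ... | y , ey , y+a≤x with rowMono b 0 0 y ey
    ...   | z , ez , z+b≤y = begin-strict
        a + b      ≡⟨ +-comm a b ⟩
        b + a      <⟨ +-monoˡ-≤ a (+-monoˡ-≤ b (proj₁ (range ez))) ⟩
        z + b + a  ≤⟨ +-monoˡ-≤ a z+b≤y ⟩
        y + a      ≤⟨ y+a≤x ⟩
        x          ∎
      where open ≤-Reasoning

    one-at-origin : 1 ≤ n → entry t 0 0 ≡ just 1
    one-at-origin 1≤n with position 1 ≤-refl 1≤n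
    ... | zero    , zero  , e = e
    ... | zero    , suc b , e with a+b<entry e
    ...   | s≤s ()
    one-at-origin 1≤n | suc a , b , e with a+b<entry e
    ...   | s≤s ()

    empty : n ≡ 0 → t ≡ []
    empty = go t rowsNonempty
      where
      go : ∀ u → RowsNonempty u → size u ≡ 0 → u ≡ []
      go []             _       _ = refl
      go ([] ∷ _)       (p ∷ _) _ = ⊥-elim (p refl)
      go ((_ ∷ _) ∷ _)  _       ()

  -- An entry x of Δ(t) in box (a , b) is x + 1 in t, in the same box or in the
  -- box directly above or to the right.
  Origin : Tableau → ℕ → ℕ → ℕ → Set
  Origin t a b x = entry t a b ≡ just x ⊎ entry t (suc a) b ≡ just x ⊎ entry t a (suc b) ≡ just x

  module Slide {t : Tableau} (S : IsStandard t) (1≤n : 1 ≤ size t) where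
    open Standard S

    Off : ℕ → ℕ → ℕ → ℕ → Set
    Off p q a b = (a , b) ≢ᶜ (p , q)

    off-col : ∀ {p q} a → Off p q a (suc q)
    off-col a (_ , e) = 1+n≢n e

    off-col² : ∀ {p q} a → Off p q a (suc (suc q))
    off-col² a (_ , e) = m+1+n≢n 1 e

    off-row : ∀ {p q} c → Off p q (suc p) c
    off-row c (e , _) = 1+n≢n e

    off-row² : ∀ {p q} c → Off p q (suc (suc p)) c
    off-row² c (e , _) = m+1+n≢n 1 e

    -- The hole box still
    -- holds its old value `holeValue` (so that value is counted twice and 1 is
    -- missing); boxes weakly above and right of the hole are untouched; every
    -- value moved so far comes from the box itself, the box above or the box
    -- to the right; rows and columns increase away from the hole; and across
    -- the hole, the boxes left of and below it are smaller than the boxes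
    -- right of and above it.
    record Inv (u : Tableau) (p q : ℕ) : Set where
      field
        nonempty    : RowsNonempty u
        shapeIn     : ∀ a b → entry u a b ≡ nothing → entry t a b ≡ nothing
        shapeOut    : ∀ a b → entry t a b ≡ nothing → entry u a b ≡ nothing
        unvisited   : ∀ a b → p ≤ a → q ≤ b → entry u a b ≡ entry t a b
        holeValue   : ℕ
        holeValue-t : entry t p q ≡ just holeValue
        origin      : ∀ a b x → entry u a b ≡ just x → Origin t a b x
        count       : ∀ x → cnt x (concat u) + δ x 1 ≡ δ x holeValue + ind n x
        rowIncrOff  : ∀ a b x y → entry u a b ≡ just x → entry u a (suc b) ≡ just y →
                      Off p q a b → Off p q a (suc b) → x < y
        colIncrOff  : ∀ a b x y → entry u a b ≡ just x → entry u (suc a) b ≡ just y →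
                      Off p q a b → Off p q (suc a) b → x < y
        leftRight   : ∀ b x y → suc b ≡ q → entry u p b ≡ just x → entry u p (suc q) ≡ just y → x < y
        belowAbove  : ∀ a x y → suc a ≡ p → entry u a q ≡ just x → entry u (suc p) q ≡ just y → x < y
        leftAbove   : ∀ b x y → suc b ≡ q → entry u p b ≡ just x → entry u (suc p) q ≡ just y → x < y
        belowRight  : ∀ a x y → suc a ≡ p → entry u a q ≡ just x → entry u p (suc q) ≡ just y → x < y

    open Inv

    start : Inv t 0 0
    start = record
      { nonempty = rowsNonempty ; shapeIn = λ _ _ e → e ; shapeOut = λ _ _ e → e ; unvisited = λ _ _ _ _ → refl
      ; holeValue = 1 ; holeValue-t = one-at-origin 1≤n ; origin = λ _ _ _ e → inj₁ e
      ; count = λ x → trans (cong (_+ δ x 1) (multiplicity x)) (+-comm (ind n x) (δ x 1))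
      ; rowIncrOff = λ a b x y e₁ e₂ _ _ → rowStep a b x y e₁ e₂
      ; colIncrOff = λ a b x y e₁ e₂ _ _ → colStep a b x y e₁ e₂
      ; leftRight = λ { _ _ _ () } ; belowAbove = λ { _ _ _ () } ; leftAbove = λ { _ _ _ () } ; belowRight = λ { _ _ _ () } }

    hole-u : ∀ {u p q} → (I : Inv u p q) → entry u p q ≡ just (holeValue I)
    hole-u {u} {p} {q} I = trans (unvisited I p q ≤-refl ≤-refl) (holeValue-t I)

    count-after : ∀ {u p q} (I : Inv u p q) v x → cnt x (concat (set u p q v)) + δ x 1 ≡ δ x v + ind n x
    count-after {u} {p} {q} I v x = +-cancelʳ-≡ (δ x (holeValue I)) _ _ (begin
        cnt x (concat (set u p q v)) + δ x 1 + δ x (holeValue I)   ≡⟨ +-swapʳ (cnt x (concat (set u p q v))) _ _ ⟩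
        cnt x (concat (set u p q v)) + δ x (holeValue I) + δ x 1   ≡⟨ cong (_+ δ x 1) (cnt-set x u p q v (holeValue I) (hole-u I)) ⟩
        cnt x (concat u) + δ x v + δ x 1                           ≡⟨ +-swapʳ (cnt x (concat u)) (δ x v) (δ x 1) ⟩
        cnt x (concat u) + δ x 1 + δ x v                           ≡⟨ cong (_+ δ x v) (count I x) ⟩
        δ x (holeValue I) + ind n x + δ x v                        ≡⟨ +-swapʳ (δ x (holeValue I)) _ _ ⟩
        δ x (holeValue I) + δ x v + ind n x                        ≡⟨ cong (_+ ind n x) (+-comm (δ x (holeValue I)) _) ⟩
        δ x v + δ x (holeValue I) + ind n x                        ≡⟨ +-swapʳ (δ x v) _ _ ⟩
        δ x v + ind n x + δ x (holeValue I)                        ∎)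
      where open ≡-Reasoning

    module Fill {u p q} (I : Inv u p q) (v : ℕ) where
      u′ : Tableau
      u′ = set u p q v

      kept : ∀ {a c x} → Off p q a c → entry u′ a c ≡ just x → entry u a c ≡ just x
      kept {a} {c} off e = trans (sym (set-ne u p q v a c off)) e

      filled : entry u′ p q ≡ just v
      filled = set-just u p q v (holeValue I) (hole-u I)

      rowIncrKept : ∀ {a c x y} → Off p q a c → Off p q a (suc c) →
                    entry u′ a c ≡ just x → entry u′ a (suc c) ≡ just y → x < y
      rowIncrKept off₁ off₂ e₁ e₂ = rowIncrOff I _ _ _ _ (kept off₁ e₁) (kept off₂ e₂) off₁ off₂

      colIncrKept : ∀ {a c x y} → Off p q a c → Off p q (suc a) c →
                    entry u′ a c ≡ just x → entry u′ (suc a) c ≡ just y → x < y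
      colIncrKept off₁ off₂ e₁ e₂ = colIncrOff I _ _ _ _ (kept off₁ e₁) (kept off₂ e₂) off₁ off₂

    slideRight : ∀ {u p q b} (I : Inv u p q) → entry u p (suc q) ≡ just b →
                 (∀ a → entry u (suc p) q ≡ just a → b < a) → Inv (set u p q b) p (suc q)
    slideRight {u} {p} {q} {b} I eb b<above = record
      { nonempty    = set-rowsNonempty u p q b (nonempty I)
      ; shapeIn     = λ a c e → shapeIn I a c (set-nothing u p q b a c e)
      ; shapeOut    = λ a c e → set-nothing′ u p q b a c (shapeOut I a c e)
      ; unvisited   = λ a c p≤a q<c → trans (set-ne u p q b a c (λ { (_ , e) → <-irrefl (sym e) q<c }))
                                             (unvisited I a c p≤a (≤-trans (n≤1+n q) q<c))
      ; holeValue   = b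
      ; holeValue-t = b-in-t
      ; origin      = origin′
      ; count       = count-after I b
      ; rowIncrOff  = rowIncr′
      ; colIncrOff  = colIncr′
      ; leftRight   = leftRight′
      ; belowAbove  = belowAbove′
      ; leftAbove   = leftAbove′
      ; belowRight  = belowRight′ }
      where
      open Fill I b
      b-in-t : entry t p (suc q) ≡ just b
      b-in-t = trans (sym (unvisited I p (suc q) ≤-refl (n≤1+n q))) eb
      left-is-b : ∀ c x → suc c ≡ suc q → entry u′ p c ≡ just x → x ≡ b
      left-is-b c x e ex = Maybe.just-injective (trans (sym (subst (λ z → entry u′ p z ≡ just x) (suc-injective e) ex)) filled)
      b-below : ∀ a → suc a ≡ p → entry u (suc a) (suc q) ≡ just b
      b-below a e = subst (λ z → entry u z (suc q) ≡ just b) (sym e) eb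
      b<right : ∀ y → entry u′ p (suc (suc q)) ≡ just y → b < y
      b<right y ey = rowIncrOff I p (suc q) b y eb (kept (off-col² p) ey) (off-col p) (off-col² p)
      b<above′ : ∀ y → entry u′ (suc p) (suc q) ≡ just y → b < y
      b<above′ y ey = colIncrOff I p (suc q) b y eb (kept (off-row (suc q)) ey) (off-col p) (off-row (suc q))
      below<b : ∀ a x → suc a ≡ p → entry u′ a (suc q) ≡ just x → x < b
      below<b a x e ex = colIncrOff I a (suc q) x b (kept (off-col a) ex) (b-below a e) (off-col a) (off-col (suc a))

      origin′ : ∀ a c x → entry u′ a c ≡ just x → Origin t a c x
      origin′ a c x e with a ≟ p | c ≟ q
      ... | yes refl | yes refl =
        inj₂ (inj₂ (subst (λ z → entry t a (suc c) ≡ just z) (Maybe.just-injective (trans (sym filled) e)) b-in-t))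
      ... | yes _    | no c≢q   = origin I a c x (kept (c≢q ∘′ proj₂) e)
      ... | no a≢p   | _        = origin I a c x (kept (a≢p ∘′ proj₁) e)

      rowIncr′ : ∀ a c x y → entry u′ a c ≡ just x → entry u′ a (suc c) ≡ just y →
                 Off p (suc q) a c → Off p (suc q) a (suc c) → x < y
      rowIncr′ a c x y e₁ e₂ _ off₂ with a ≟ p
      ... | no a≢p = rowIncrKept (a≢p ∘′ proj₁) (a≢p ∘′ proj₁) e₁ e₂
      ... | yes refl with c ≟ q
      ...   | yes refl = ⊥-elim (off₂ (refl , refl))
      ...   | no c≢q with suc c ≟ q
      ...     | yes e = subst (x <_) (sym y≡b) (leftRight I c x b e (kept (c≢q ∘′ proj₂) e₁) eb)
        where
        y≡b : y ≡ b
        y≡b = Maybe.just-injective (trans (sym e₂) (subst (λ z → entry u′ a z ≡ just b) (sym e) filled))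
      ...     | no 1+c≢q = rowIncrKept (c≢q ∘′ proj₂) (1+c≢q ∘′ proj₂) e₁ e₂

      colIncr′ : ∀ a c x y → entry u′ a c ≡ just x → entry u′ (suc a) c ≡ just y →
                 Off p (suc q) a c → Off p (suc q) (suc a) c → x < y
      colIncr′ a c x y e₁ e₂ _ _ with c ≟ q
      ... | no c≢q = colIncrKept (c≢q ∘′ proj₂) (c≢q ∘′ proj₂) e₁ e₂
      ... | yes refl with a ≟ p
      ...   | yes refl =
        subst (_< y) (sym (Maybe.just-injective (trans (sym e₁) filled))) (b<above y (kept (off-row c) e₂))
      ...   | no a≢p with suc a ≟ p
      ...     | yes e = subst (x <_) (sym y≡b) (belowRight I a x b e (kept (a≢p ∘′ proj₁) e₁) eb)
        where
        y≡b : y ≡ b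
        y≡b = Maybe.just-injective (trans (sym e₂) (subst (λ z → entry u′ z c ≡ just b) (sym e) filled))
      ...     | no 1+a≢p = colIncrKept (a≢p ∘′ proj₁) (1+a≢p ∘′ proj₁) e₁ e₂

      leftRight′ : ∀ c x y → suc c ≡ suc q → entry u′ p c ≡ just x → entry u′ p (suc (suc q)) ≡ just y → x < y
      leftRight′ c x y e ex ey = subst (_< y) (sym (left-is-b c x e ex)) (b<right y ey)
      belowAbove′ : ∀ a x y → suc a ≡ p → entry u′ a (suc q) ≡ just x → entry u′ (suc p) (suc q) ≡ just y → x < y
      belowAbove′ a x y e ex ey = <-trans (below<b a x e ex) (b<above′ y ey)
      leftAbove′ : ∀ c x y → suc c ≡ suc q → entry u′ p c ≡ just x → entry u′ (suc p) (suc q) ≡ just y → x < y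
      leftAbove′ c x y e ex ey = subst (_< y) (sym (left-is-b c x e ex)) (b<above′ y ey)
      belowRight′ : ∀ a x y → suc a ≡ p → entry u′ a (suc q) ≡ just x → entry u′ p (suc (suc q)) ≡ just y → x < y
      belowRight′ a x y e ex ey = <-trans (below<b a x e ex) (b<right y ey)

    slideUp : ∀ {u p q a} (I : Inv u p q) → entry u (suc p) q ≡ just a →
              (∀ b → entry u p (suc q) ≡ just b → a < b) → Inv (set u p q a) (suc p) q
    slideUp {u} {p} {q} {a} I ea a<right = record
      { nonempty    = set-rowsNonempty u p q a (nonempty I)
      ; shapeIn     = λ r c e → shapeIn I r c (set-nothing u p q a r c e)
      ; shapeOut    = λ r c e → set-nothing′ u p q a r c (shapeOut I r c e)
      ; unvisited   = λ r c p<r q≤c → trans (set-ne u p q a r c (λ { (e , _) → <-irrefl (sym e) p<r }))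
                                             (unvisited I r c (≤-trans (n≤1+n p) p<r) q≤c)
      ; holeValue   = a
      ; holeValue-t = a-in-t
      ; origin      = origin′
      ; count       = count-after I a
      ; rowIncrOff  = rowIncr′
      ; colIncrOff  = colIncr′
      ; leftRight   = leftRight′
      ; belowAbove  = belowAbove′
      ; leftAbove   = leftAbove′
      ; belowRight  = belowRight′ }
      where
      open Fill I a
      a-in-t : entry t (suc p) q ≡ just a
      a-in-t = trans (sym (unvisited I (suc p) q (n≤1+n p) ≤-refl)) ea
      below-is-a : ∀ r x → suc r ≡ suc p → entry u′ r q ≡ just x → x ≡ a
      below-is-a r x e ex = Maybe.just-injective (trans (sym (subst (λ z → entry u′ z q ≡ just x) (suc-injective e) ex)) filled)
      a-left : ∀ c → suc c ≡ q → entry u (suc p) (suc c) ≡ just a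
      a-left c e = subst (λ z → entry u (suc p) z ≡ just a) (sym e) ea
      a<right′ : ∀ y → entry u′ (suc p) (suc q) ≡ just y → a < y
      a<right′ y ey = rowIncrOff I (suc p) q a y ea (kept (off-row (suc q)) ey) (off-row q) (off-row (suc q))
      a<above : ∀ y → entry u′ (suc (suc p)) q ≡ just y → a < y
      a<above y ey = colIncrOff I (suc p) q a y ea (kept (off-row² q) ey) (off-row q) (off-row² q)
      left<a : ∀ c x → suc c ≡ q → entry u′ (suc p) c ≡ just x → x < a
      left<a c x e ex = rowIncrOff I (suc p) c x a (kept (off-row c) ex) (a-left c e) (off-row c) (off-row (suc c))

      origin′ : ∀ r c x → entry u′ r c ≡ just x → Origin t r c x
      origin′ r c x e with r ≟ p | c ≟ q
      ... | yes refl | yes refl =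
        inj₂ (inj₁ (subst (λ z → entry t (suc r) c ≡ just z) (Maybe.just-injective (trans (sym filled) e)) a-in-t))
      ... | yes _    | no c≢q   = origin I r c x (kept (c≢q ∘′ proj₂) e)
      ... | no r≢p   | _        = origin I r c x (kept (r≢p ∘′ proj₁) e)

      rowIncr′ : ∀ r c x y → entry u′ r c ≡ just x → entry u′ r (suc c) ≡ just y →
                 Off (suc p) q r c → Off (suc p) q r (suc c) → x < y
      rowIncr′ r c x y e₁ e₂ _ _ with r ≟ p
      ... | no r≢p = rowIncrKept (r≢p ∘′ proj₁) (r≢p ∘′ proj₁) e₁ e₂
      ... | yes refl with c ≟ q
      ...   | yes refl =
        subst (_< y) (sym (Maybe.just-injective (trans (sym e₁) filled))) (a<right y (kept (off-col r) e₂))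
      ...   | no c≢q with suc c ≟ q
      ...     | yes e = subst (x <_) (sym y≡a) (leftAbove I c x a e (kept (c≢q ∘′ proj₂) e₁) ea)
        where
        y≡a : y ≡ a
        y≡a = Maybe.just-injective (trans (sym e₂) (subst (λ z → entry u′ r z ≡ just a) (sym e) filled))
      ...     | no 1+c≢q = rowIncrKept (c≢q ∘′ proj₂) (1+c≢q ∘′ proj₂) e₁ e₂

      colIncr′ : ∀ r c x y → entry u′ r c ≡ just x → entry u′ (suc r) c ≡ just y →
                 Off (suc p) q r c → Off (suc p) q (suc r) c → x < y
      colIncr′ r c x y e₁ e₂ _ off₂ with c ≟ q
      ... | no c≢q = colIncrKept (c≢q ∘′ proj₂) (c≢q ∘′ proj₂) e₁ e₂
      ... | yes refl with r ≟ p
      ...   | yes refl = ⊥-elim (off₂ (refl , refl))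
      ...   | no r≢p with suc r ≟ p
      ...     | yes e = subst (x <_) (sym y≡a) (belowAbove I r x a e (kept (r≢p ∘′ proj₁) e₁) ea)
        where
        y≡a : y ≡ a
        y≡a = Maybe.just-injective (trans (sym e₂) (subst (λ z → entry u′ z c ≡ just a) (sym e) filled))
      ...     | no 1+r≢p = colIncrKept (r≢p ∘′ proj₁) (1+r≢p ∘′ proj₁) e₁ e₂

      leftRight′ : ∀ c x y → suc c ≡ q → entry u′ (suc p) c ≡ just x → entry u′ (suc p) (suc q) ≡ just y → x < y
      leftRight′ c x y e ex ey = <-trans (left<a c x e ex) (a<right′ y ey)
      belowAbove′ : ∀ r x y → suc r ≡ suc p → entry u′ r q ≡ just x → entry u′ (suc (suc p)) q ≡ just y → x < y
      belowAbove′ r x y e ex ey = subst (_< y) (sym (below-is-a r x e ex)) (a<above y ey)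
      leftAbove′ : ∀ c x y → suc c ≡ q → entry u′ (suc p) c ≡ just x → entry u′ (suc (suc p)) q ≡ just y → x < y
      leftAbove′ c x y e ex ey = <-trans (left<a c x e ex) (a<above y ey)
      belowRight′ : ∀ r x y → suc r ≡ suc p → entry u′ r q ≡ just x → entry u′ (suc p) (suc q) ≡ just y → x < y
      belowRight′ r x y e ex ey = subst (_< y) (sym (below-is-a r x e ex)) (a<right′ y ey)

    Finished : Tableau × (ℕ × ℕ) → Set
    Finished (u , (i , j)) = Inv u i j × entry u (suc i) j ≡ nothing × entry u i (suc j) ≡ nothing

    inT : ∀ {u p q a b x} → Inv u p q → entry u a b ≡ just x → Σ ℕ λ y → entry t a b ≡ just y
    inT {u} {p} {q} {a} {b} I e with entry t a b in et
    ... | just y  = y , refl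
    ... | nothing = ⊥-elim (nothing≢just (trans (sym (shapeOut I a b et)) e))

    inU : ∀ {u p q a b y} → Inv u p q → entry t a b ≡ just y → Σ ℕ λ x → entry u a b ≡ just x
    inU {u} {p} {q} {a} {b} I et with entry u a b in eu
    ... | just x  = x , refl
    ... | nothing = ⊥-elim (nothing≢just (trans (sym (shapeIn I a b eu)) et))

    -- Each step moves the hole from diagonal p + q to p + q + 1, and boxes of
    -- t lie on diagonals below n, so n steps of fuel always suffice.
    fuelSuffices : ∀ {u p q a b x} → Inv u p q → n ≤ p + q → entry u a b ≡ just x → p + q < a + b → ⊥
    fuelSuffices {u} {p} {q} {a} {b} I n≤p+q e p+q<a+b with inT I e
    ... | _ , et = <-irrefl refl (≤-trans (≤-trans (s≤s n≤p+q) p+q<a+b) (<⇒≤ (cell-size t a b rowsNonempty et)))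

    -- The two neighbours of the hole never tie: both are values of t other
    -- than the duplicated hole value, hence occur only once.
    neighboursDiffer : ∀ {u p q a} → (I : Inv u p q) → entry u (suc p) q ≡ just a → entry u p (suc q) ≡ just a → ⊥
    neighboursDiffer {u} {p} {q} {a} I e₁ e₂ with ≤-trans twice atMostOnce
      where
      twice : 2 ≤ cnt a (concat u)
      twice = two-cells a u (suc p) q p (suc q) e₁ e₂ (λ { (e , _) → 1+n≢n e })
      hole<a : holeValue I < a
      hole<a = colStep p q (holeValue I) a (holeValue-t I) (trans (sym (unvisited I (suc p) q (n≤1+n p) ≤-refl)) e₁)
      atMostOnce : cnt a (concat u) ≤ 1
      atMostOnce = begin
        cnt a (concat u)               ≤⟨ m≤m+n _ (δ a 1) ⟩
        cnt a (concat u) + δ a 1       ≡⟨ count I a ⟩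
        δ a (holeValue I) + ind n a    ≡⟨ cong (_+ ind n a) (δ-≢ (λ e → <-irrefl (sym e) hole<a)) ⟩
        ind n a                        ≤⟨ ind≤1 n a ⟩
        1                              ∎
        where open ≤-Reasoning
    ... | s≤s ()

    slide-finishes : ∀ f u p q → Inv u p q → n ≤ p + q + f → Finished (slide f u p q)

    goUp : ∀ f u p q → Inv u p q → n ≤ p + q + suc f → ∀ a → entry u (suc p) q ≡ just a →
           (∀ b → entry u p (suc q) ≡ just b → a < b) → Finished (slide f (set u p q a) (suc p) q)
    goUp f u p q I n≤ a eA a<right = slide-finishes f (set u p q a) (suc p) q (slideUp I eA a<right)
      (subst (n ≤_) (+-suc (p + q) f) n≤)

    goRight : ∀ f u p q → Inv u p q → n ≤ p + q + suc f → ∀ b → entry u p (suc q) ≡ just b →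
              (∀ a → entry u (suc p) q ≡ just a → b < a) → Finished (slide f (set u p q b) p (suc q))
    goRight f u p q I n≤ b eB b<above = slide-finishes f (set u p q b) p (suc q) (slideRight I eB b<above)
      (subst (n ≤_) (trans (+-suc (p + q) f) (cong (_+ f) (sym (+-suc p q)))) n≤)

    slide-finishes zero u p q I n≤ with entry u (suc p) q in eA | entry u p (suc q) in eB
    ... | nothing | nothing = I , refl , refl
    ... | just a  | _       = ⊥-elim (fuelSuffices I (subst (n ≤_) (+-identityʳ _) n≤) eA ≤-refl)
    ... | nothing | just b  = ⊥-elim (fuelSuffices I (subst (n ≤_) (+-identityʳ _) n≤) eB (≤-reflexive (sym (+-suc p q))))
    slide-finishes (suc f) u p q I n≤ with entry u (suc p) q in eA | entry u p (suc q) in eB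
    ... | nothing | nothing = I , eA , eB
    ... | just a  | nothing = goUp f u p q I n≤ a eA (λ b e → ⊥-elim (nothing≢just (trans (sym eB) e)))
    ... | nothing | just b  = goRight f u p q I n≤ b eB (λ a e → ⊥-elim (nothing≢just (trans (sym eA) e)))
    ... | just a  | just b with a <ᵇ b in a<ᵇb
    ...   | true  = goUp f u p q I n≤ a eA (λ b′ e → subst (a <_) (Maybe.just-injective (trans (sym eB) e)) a<b)
      where
      a<b : a < b
      a<b = <ᵇ⇒< a b (subst T (sym a<ᵇb) _)
    ...   | false = goRight f u p q I n≤ b eB (λ a′ e → subst (b <_) (Maybe.just-injective (trans (sym eA) e)) b<a)
      where
      b<a : b < a
      b<a with <-cmp a b
      ... | tri< a<b _ _ = ⊥-elim (subst T a<ᵇb (<⇒<ᵇ a<b))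
      ... | tri≈ _ refl _ = ⊥-elim (neighboursDiffer I eA eB)
      ... | tri> _ _ b<a = b<a

    module Result (u : Tableau) (i j : ℕ) (I : Inv u i j)
                  (noAbove : entry u (suc i) j ≡ nothing) (noRight : entry u i (suc j) ≡ nothing) where
      w : ℕ
      w = holeValue I

      v : Tableau
      v = removeLast u i

      d : Tableau
      d = decr v

      corner : OuterCorner u i j w
      corner = hole-u I , noRight , noAbove

      v-count : ∀ x → cnt x (concat v) + δ x 1 ≡ ind n x
      v-count x = +-cancelˡ-≡ (δ x w) _ _ (begin
          δ x w + (cnt x (concat v) + δ x 1)   ≡⟨ sym (+-assoc (δ x w) _ _) ⟩
          δ x w + cnt x (concat v) + δ x 1     ≡⟨ cong (_+ δ x 1) (+-comm (δ x w) _) ⟩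
          cnt x (concat v) + δ x w + δ x 1     ≡⟨ cong (_+ δ x 1) (removeLast-cnt x u i j w (hole-u I) noRight) ⟩
          cnt x (concat u) + δ x 1             ≡⟨ count I x ⟩
          δ x w + ind n x                      ∎)
        where open ≡-Reasoning

      no0 : cnt 0 (concat v) ≡ 0
      no0 = m+n≡0⇒m≡0 _ (v-count 0)

      v-pos : ∀ {a b y} → entry v a b ≡ just y → 1 ≤ y
      v-pos {a} {b} {zero}  e = ⊥-elim (<-irrefl (sym no0) (one-cell 0 v a b e))
      v-pos {a} {b} {suc y} e = s≤s z≤n

      v⇒u : ∀ {a b y} → entry v a b ≡ just y → Off i j a b × entry u a b ≡ just y
      v⇒u {a} {b} e = off , trans (sym (removeLast-others u i j w (nonempty I) corner a b off)) e
        where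
        off : Off i j a b
        off (refl , refl) = nothing≢just (trans (sym (removeLast-corner u i j w (nonempty I) corner)) e)

      d⇒v : ∀ {a b x} → entry d a b ≡ just x → entry v a b ≡ just (suc x)
      d⇒v {a} {b} e with entry v a b in ev | decr-entry v a b
      ... | nothing    | eq = ⊥-elim (nothing≢just (trans (sym eq) e))
      ... | just zero  | _  = ⊥-elim (<-irrefl refl (v-pos ev))
      ... | just (suc y) | eq = cong (just ∘′ suc) (Maybe.just-injective (trans (sym eq) e))

      d⇒u : ∀ {a b x} → entry d a b ≡ just x → Off i j a b × entry u a b ≡ just (suc x)
      d⇒u = v⇒u ∘′ d⇒v

      u⇒v : ∀ {a b x} → entry u a b ≡ just x → Off i j a b → entry v a b ≡ just x
      u⇒v {a} {b} e off = trans (removeLast-others u i j w (nonempty I) corner a b off) e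

      u-pos : ∀ {a b x} → entry u a b ≡ just x → Off i j a b → 1 ≤ x
      u-pos e off = v-pos (u⇒v e off)

      u⇒d : ∀ {a b x} → entry u a b ≡ just x → Off i j a b → entry d a b ≡ just (pred x)
      u⇒d {a} {b} e off = trans (decr-entry v a b) (cong (Maybe.map pred) (u⇒v e off))

      pred< : ∀ {x y} → 1 ≤ x → x < suc y → pred x < y
      pred< {suc x} _ (s≤s x<y) = x<y

      -- Rows and columns of d increase: the box before a box of d is a box of
      -- t, hence of u, and is not the hole, which is an outer corner of u.
      d-rowIncr : ∀ a b y → entry d a (suc b) ≡ just y → Σ ℕ λ x → entry d a b ≡ just x × x < y
      d-rowIncr a b y e with d⇒u e
      ... | off′ , e′ with inT I e′
      ...   | _ , et with rowIncr a b _ et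
      ...     | _ , et₀ , _ with inU I et₀
      ...       | x , eu = pred x , u⇒d eu off , pred< (u-pos eu off) (rowIncrOff I a b x (suc y) eu e′ off off′)
        where
        off : Off i j a b
        off (refl , refl) = nothing≢just (trans (sym noRight) e′)

      d-colIncr : ∀ a b y → entry d (suc a) b ≡ just y → Σ ℕ λ x → entry d a b ≡ just x × x < y
      d-colIncr a b y e with d⇒u e
      ... | off′ , e′ with inT I e′
      ...   | _ , et with colIncr a b _ et
      ...     | _ , et₀ , _ with inU I et₀
      ...       | x , eu = pred x , u⇒d eu off , pred< (u-pos eu off) (colIncrOff I a b x (suc y) eu e′ off off′)
        where
        off : Off i j a b
        off (refl , refl) = nothing≢just (trans (sym noAbove) e′)

      d-count : ∀ x → cnt x (concat d) ≡ ind (n ∸ 1) x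
      d-count x = +-cancelˡ-≡ (δ (suc x) 1) _ _ (begin
          δ (suc x) 1 + cnt x (concat d)        ≡⟨ cong (δ (suc x) 1 +_) (cnt-decr x v no0) ⟩
          δ (suc x) 1 + cnt (suc x) (concat v)  ≡⟨ +-comm (δ (suc x) 1) _ ⟩
          cnt (suc x) (concat v) + δ (suc x) 1  ≡⟨ v-count (suc x) ⟩
          ind n (suc x)                         ≡⟨ ind-shift n x 1≤n ⟩
          δ (suc x) 1 + ind (n ∸ 1) x           ∎)
        where open ≡-Reasoning

      d-entries : concat d ↭ map suc (upTo (n ∸ 1))
      d-entries = cnt⇒↭ (concat d) _ (λ x → trans (d-count x) (sym (cnt-upTo x (n ∸ 1))))

      d-size : size d ≡ n ∸ 1
      d-size = trans (↭-length d-entries) (trans (List.length-map suc (upTo (n ∸ 1))) (List.length-upTo (n ∸ 1)))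

      d-standard : IsStandard d
      d-standard = record
        { rowsNonempty = decr-rowsNonempty v (removeLast-rowsNonempty u i (nonempty I))
        ; rowIncr      = d-rowIncr
        ; colIncr      = d-colIncr
        ; entries      = subst (λ k → concat d ↭ map suc (upTo k)) (sym d-size) d-entries }

      d-origin : ∀ a b x → entry d a b ≡ just x → Origin t a b (suc x)
      d-origin a b x e = origin I a b (suc x) (proj₂ (d⇒u e))

  record DeltaFacts (t : Tableau) : Set where
    field
      i j        : ℕ
      diag       : diagRemoved t ≡ ℤ.+ j ℤ.- ℤ.+ i
      removedBox : Σ ℕ λ w → entry t i j ≡ just w
      standard   : IsStandard (Δ t)
      size-Δ     : size (Δ t) ≡ size t ∸ 1
      origin     : ∀ a b x → entry (Δ t) a b ≡ just x → Origin t a b (suc x)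

  deltaFacts : ∀ t → IsStandard t → 1 ≤ size t → DeltaFacts t
  deltaFacts t S 1≤n = record
    { i = i ; j = j
    ; diag = diag-eq
    ; removedBox = holeValue I , holeValue-t I
    ; standard = subst IsStandard (sym Δ-eq) d-standard
    ; size-Δ = subst (λ s → size s ≡ size t ∸ 1) (sym Δ-eq) d-size
    ; origin = λ a b x e → d-origin a b x (subst (λ s → entry s a b ≡ just x) Δ-eq e) }
    where
    open Slide S 1≤n
    open Inv
    finished : Finished (slideResult t)
    finished = slide-finishes (size t) t 0 0 start ≤-refl
    i j : ℕ
    i = proj₁ (proj₂ (slideResult t))
    j = proj₂ (proj₂ (slideResult t))
    I : Inv (proj₁ (slideResult t)) i j
    I = proj₁ finished
    open Result (proj₁ (slideResult t)) i j I (proj₁ (proj₂ finished)) (proj₂ (proj₂ finished))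

    Δ-eq : Δ t ≡ decr (removeLast (proj₁ (slideResult t)) i)
    Δ-eq with slideResult t
    ... | _ = refl

    diag-eq : diagRemoved t ≡ ℤ.+ j ℤ.- ℤ.+ i
    diag-eq with slideResult t
    ... | _ = refl

  firstFailure : (P : ℕ → Set) → (∀ c → Dec (P c)) → ∀ n → (∀ c → P c → c < n) →
                 ∀ h → (∀ c → c < h → P c) → Σ ℕ λ h′ → h ≤ h′ × (∀ c → c < h′ → P c) × ¬ P h′
  firstFailure P P? n bounded h below = search n h below (m≤n+m n h)
    where
    search : ∀ fuel h → (∀ c → c < h → P c) → n ≤ h + fuel → Σ ℕ λ h′ → h ≤ h′ × (∀ c → c < h′ → P c) × ¬ P h′
    search fuel h below n≤ with P? h
    ... | no ¬Ph = h , ≤-refl , below , ¬Ph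
    search zero h below n≤ | yes Ph = ⊥-elim (<-irrefl refl (≤-trans (bounded h Ph) (subst (n ≤_) (+-identityʳ h) n≤)))
    search (suc fuel) h below n≤ | yes Ph with search fuel (suc h) below′ (subst (n ≤_) (+-suc h fuel) n≤)
      where
      below′ : ∀ c → c < suc h → P c
      below′ c c<1+h with c ≟ h
      ... | yes refl = Ph
      ... | no c≢h   = below c (≤∧≢⇒< (s≤s⁻¹ c<1+h) c≢h)
    ... | h′ , 1+h≤h′ , below″ , ¬Ph′ = h′ , ≤-trans (n≤1+n h) 1+h≤h′ , below″ , ¬Ph′

  even-or-odd : ∀ k → 2 ∣ k ⊎ Σ ℕ λ g → k ≡ suc g × 2 ∣ g
  even-or-odd zero = inj₁ (divides 0 refl)
  even-or-odd (suc k) with even-or-odd k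
  ... | inj₁ 2∣k = inj₂ (k , refl , 2∣k)
  ... | inj₂ (g , refl , divides q g≡) = inj₁ (divides (suc q) (cong (suc ∘′ suc) g≡))

  -- The first column of s begins 1, 2, …, h (the column run) and the bottom
  -- row begins 1, 2, …, r + 1 (the row run); "stop" says the run ends there.
  ColumnRun : Tableau → ℕ → Set
  ColumnRun s h = ∀ c → c < h → entry s c 0 ≡ just (suc c)

  ColumnStop : Tableau → ℕ → Set
  ColumnStop s h = ¬ entry s h 0 ≡ just (suc h)

  RowRun : Tableau → ℕ → Set
  RowRun s r = ∀ c → c ≤ r → entry s 0 c ≡ just (suc c)

  RowStop : Tableau → ℕ → Set
  RowStop s r = ¬ entry s 0 (suc r) ≡ just (suc (suc r))

  _≟ᴹ_ : (a b : Maybe ℕ) → Dec (a ≡ b)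
  _≟ᴹ_ = Maybe.≡-dec _≟_

  module Runs {s : Tableau} (S : IsStandard s) where
    open Standard S

    maximalColumnRun : 1 ≤ n → Σ ℕ λ h → 1 ≤ h × ColumnRun s h × ColumnStop s h
    maximalColumnRun 1≤n
      with firstFailure (λ c → entry s c 0 ≡ just (suc c)) (λ c → entry s c 0 ≟ᴹ just (suc c)) n
             (λ c e → proj₂ (range e)) 1 (λ { zero _ → one-at-origin 1≤n ; (suc _) (s≤s ()) })
    ... | h , 1≤h , run , stop = h , 1≤h , run , stop

    maximalRowRun : 1 ≤ n → Σ ℕ λ r → RowRun s r × RowStop s r
    maximalRowRun 1≤n
      with firstFailure (λ c → entry s 0 c ≡ just (suc c)) (λ c → entry s 0 c ≟ᴹ just (suc c)) n
             (λ c e → proj₂ (range e)) 1 (λ { zero _ → one-at-origin 1≤n ; (suc _) (s≤s ()) })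
    ... | suc r , _ , run , stop = r , (λ c c≤r → run c (s≤s c≤r)) , stop

    columnRun≤n : ∀ {h} → ColumnRun s h → h ≤ n
    columnRun≤n {zero}  _   = z≤n
    columnRun≤n {suc h} run = proj₂ (range (run h ≤-refl))

    placeOf2 : 2 ≤ n → entry s 0 1 ≡ just 2 ⊎ entry s 1 0 ≡ just 2
    placeOf2 2≤n with position 2 (s≤s z≤n) 2≤n
    ... | zero , zero , e with Maybe.just-injective (trans (sym (one-at-origin (≤-trans (s≤s z≤n) 2≤n))) e)
    ...   | ()
    placeOf2 2≤n | zero , suc zero , e = inj₁ e
    placeOf2 2≤n | suc zero , zero , e = inj₂ e
    placeOf2 2≤n | zero , suc (suc b) , e with a+b<entry e
    ... | s≤s (s≤s ())
    placeOf2 2≤n | suc zero , suc b , e with a+b<entry e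
    ... | s≤s (s≤s ())
    placeOf2 2≤n | suc (suc a) , b , e with a+b<entry e
    ... | s≤s (s≤s ())

    -- Within a column run no y < h is an ascent: y + 1 lies right above y.
    noAscentInRun : ∀ {h} → ColumnRun s h → ∀ y → y < h → ¬ Ascent s y
    noAscentInRun {h} run y y<h ((_ , _) , inj₁ y≡n) = <-irrefl y≡n (≤-trans y<h (columnRun≤n run))
    noAscentInRun {h} run (suc y) y<h ((_ , _) , inj₂ (i , i′ , (_ , ey) , (_ , ey′) , i′≤i))
      with distinct ey (run y (≤-trans (n≤1+n _) y<h)) | distinct ey′ (run (suc y) y<h)
    ... | refl , _ | refl , _ = <-irrefl refl i′≤i

    -- At the end of a column run the value h is an ascent: h + 1 cannot be
    -- above h, so it lies in a lower row.
    ascentAtStop : ∀ {h} → 1 ≤ h → ColumnRun s h → ColumnStop s h → Ascent s h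
    ascentAtStop {suc g} 1≤h run stop with suc g ≟ n
    ... | yes h≡n = (1≤h , columnRun≤n run) , inj₁ h≡n
    ... | no h≢n with position (suc (suc g)) (s≤s z≤n) (≤∧≢⇒< (columnRun≤n run) h≢n)
    ...   | a , b , e = (1≤h , columnRun≤n run) , inj₂ (g , a , (0 , run g ≤-refl) , (b , e) , a≤g a b e)
      where
      a≤g : ∀ a b → entry s a b ≡ just (suc (suc g)) → a ≤ g
      a≤g a b e with a ≤? g
      ... | yes a≤g = a≤g
      a≤g a zero e | no a≰g = ⊥-elim (stop (subst (λ k → entry s k 0 ≡ just _) a≡h e))
        where
        a≡h : a ≡ suc g
        a≡h = ≤-antisym (subst (_≤ suc g) (+-identityʳ a) (s≤s⁻¹ (a+b<entry e))) (≰⇒> a≰g)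
      a≤g a (suc b) e | no a≰g =
        ⊥-elim (<-irrefl refl (≤-trans (s≤s (≰⇒> a≰g)) (≤-trans (m<m+n a (s≤s z≤n)) (s≤s⁻¹ (a+b<entry e)))))

    evenRun⇒derangement : ∀ {h} → 1 ≤ h → ColumnRun s h → ColumnStop s h → 2 ∣ h → IsDerangement s
    evenRun⇒derangement {h} 1≤h run stop 2∣h = inj₂ (h , ascentAtStop 1≤h run stop , 2∣h , noAscentInRun run)

  -- Under Δ, the column run and the row run of a standard tableau s move
  -- down by one: the value c + 2 of s becomes c + 1 one box lower or to the left.
  module RunsUnderΔ {s : Tableau} (S : IsStandard s) (1≤n : 1 ≤ size s) where
    open Standard S
    open DeltaFacts (deltaFacts s S 1≤n)
    module SΔ = Standard standard

    private
      valueExceedsDiagonal : ∀ {a b c} → a + b ≡ suc c → ¬ entry (Δ s) a b ≡ just (suc c)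
      valueExceedsDiagonal a+b≡ e = <-irrefl a+b≡ (SΔ.a+b<entry e)

    -- Each value c + 1 of the column run of Δ(s) comes from c + 2 in the
    -- column run of s, which lies one box higher.
    columnRun-Δ : ∀ g → ColumnRun s (suc g) → g ≤ size (Δ s) → ColumnRun (Δ s) g
    columnRun-Δ g run g≤ c c<g with SΔ.position (suc c) (s≤s z≤n) (≤-trans c<g g≤)
    ... | a , b , e with origin a b (suc c) e
    ...   | inj₁ e′ with distinct e′ (run (suc c) (s≤s c<g))
    ...     | refl , refl = ⊥-elim (valueExceedsDiagonal (+-identityʳ (suc c)) e)
    columnRun-Δ g run g≤ c c<g | a , b , e | inj₂ (inj₁ e′) with distinct e′ (run (suc c) (s≤s c<g))
    ...     | refl , refl = e
    columnRun-Δ g run g≤ c c<g | a , b , e | inj₂ (inj₂ e′) with distinct e′ (run (suc c) (s≤s c<g))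
    ...     | _ , ()

    rowRun-Δ : ∀ r → RowRun s (suc r) → suc r ≤ size (Δ s) → RowRun (Δ s) r
    rowRun-Δ r run r< c c≤r with SΔ.position (suc c) (s≤s z≤n) (≤-trans (s≤s c≤r) r<)
    ... | a , b , e with origin a b (suc c) e
    ...   | inj₁ e′ with distinct e′ (run (suc c) (s≤s c≤r))
    ...     | refl , refl = ⊥-elim (valueExceedsDiagonal refl e)
    rowRun-Δ r run r< c c≤r | a , b , e | inj₂ (inj₁ e′) with distinct e′ (run (suc c) (s≤s c≤r))
    ...     | () , _
    rowRun-Δ r run r< c c≤r | a , b , e | inj₂ (inj₂ e′) with distinct e′ (run (suc c) (s≤s c≤r))
    ...     | refl , refl = e

    -- If 2 is not right of 1, the column run of Δ(s) is one shorter than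
    -- that of s: the value g + 2 would otherwise sit at (g , 1), forcing 2
    -- at (0 , 1).
    columnStop-Δ : ∀ g → ColumnRun s (suc g) → ColumnStop s (suc g) → ¬ entry s 0 1 ≡ just 2 → ColumnStop (Δ s) g
    columnStop-Δ g run stop 2∉right e with origin g 0 (suc g) e
    ... | inj₁ e′ with Maybe.just-injective (trans (sym (run g ≤-refl)) e′)
    ...   | eq = <-irrefl eq (n<1+n (suc g))
    columnStop-Δ g run stop 2∉right e | inj₂ (inj₁ e′) = stop e′
    columnStop-Δ g run stop 2∉right e | inj₂ (inj₂ e′) with colMono g 0 1 (suc (suc g)) e′
    ... | y , ey , y+g≤ = 2∉right (subst (λ k → entry s 0 1 ≡ just k) y≡2 ey)
      where
      y≡2 : y ≡ 2
      y≡2 = ≤-antisym (+-cancelʳ-≤ g y 2 y+g≤)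
                      (rowStep 0 0 1 y (run 0 (s≤s z≤n)) ey)

    -- Likewise the row run of Δ(s) is one shorter than that of s (when that
    -- has length at least two): otherwise r + 3 sits at (1 , r + 1), forcing
    -- 2 at (1 , 0) although it is at (0 , 1).
    rowStop-Δ : ∀ r → RowRun s (suc r) → RowStop s (suc r) → RowStop (Δ s) r
    rowStop-Δ r run stop e with origin 0 (suc r) (suc (suc r)) e
    ... | inj₁ e′ = <-irrefl (Maybe.just-injective (trans (sym (run (suc r) ≤-refl)) e′)) ≤-refl
    ... | inj₂ (inj₂ e′) = stop e′
    ... | inj₂ (inj₁ e′) with rowMono (suc r) 1 0 _ e′
    ...   | y , ey , y+r≤ with distinct (subst (λ k → entry s 1 0 ≡ just k) y≡2 ey) (run 1 (s≤s z≤n))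
      where
      y≡2 : y ≡ 2
      y≡2 = ≤-antisym (+-cancelʳ-≤ (suc r) y 2 y+r≤) (colStep 0 0 1 y (run 0 z≤n) ey)
    ...     | () , _

  iter-shift : ∀ m (f : Tableau → Tableau) t → iter m f (f t) ≡ iter (suc m) f t
  iter-shift zero    f t = refl
  iter-shift (suc m) f t = cong f (iter-shift m f t)

  DerangedWithin : ℕ → Tableau → Set
  DerangedWithin k s = Σ ℕ λ m → m ≤ k × IsDerangement (iter m Δ s)

  type≤ : ∀ {t J k} → IsType t J → DerangedWithin k t → J ≤ k
  type≤ {J = J} (_ , minimal) (m , m≤k , deranged) with J ≤? m
  ... | yes J≤m = ≤-trans J≤m m≤k
  ... | no J≰m  = ⊥-elim (minimal m (≰⇒> J≰m) deranged)

  -- Row run of length one: the column run of s, or else that of Δ(s), has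
  -- even length, unless s is the single box 1 and Δ(s) is empty.
  module ShortRow {s : Tableau} (S : IsStandard s) (1≤n : 1 ≤ size s) (2∉right : RowStop s 0) where
    open Runs S
    open RunsUnderΔ S 1≤n
    open DeltaFacts (deltaFacts s S 1≤n)
    module RunsΔ = Runs standard

    -- With 2 neither above nor right of 1, the value 2 does not occur.
    singleBox : ColumnStop s 1 → Δ s ≡ []
    singleBox stop = Standard.empty standard (trans size-Δ n∸1≡0)
      where
      n∸1≡0 : size s ∸ 1 ≡ 0
      n∸1≡0 with 2 ≤? size s
      ... | no 2≰n = m≤n⇒m∸n≡0 (∸-monoˡ-≤ 1 (≰⇒> 2≰n))
      ... | yes 2≤n with placeOf2 2≤n
      ...   | inj₁ right = ⊥-elim (2∉right right)
      ...   | inj₂ above = ⊥-elim (stop above)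

    oddRun : ∀ g → ColumnRun s (suc (suc g)) → ColumnStop s (suc (suc g)) → 2 ∣ suc g → IsDerangement (Δ s)
    oddRun g run stop 2∣g = RunsΔ.evenRun⇒derangement (s≤s z≤n) runΔ stopΔ 2∣g
      where
      runΔ : ColumnRun (Δ s) (suc g)
      runΔ = columnRun-Δ (suc g) run (subst (suc g ≤_) (sym size-Δ) (∸-monoˡ-≤ 1 (columnRun≤n run)))
      stopΔ : ColumnStop (Δ s) (suc g)
      stopΔ = columnStop-Δ (suc g) run stop 2∉right

    bound : DerangedWithin 1 s
    bound with maximalColumnRun 1≤n
    ... | h , 1≤h , run , stop with even-or-odd h
    ...   | inj₁ 2∣h                 = 0 , z≤n , evenRun⇒derangement 1≤h run stop 2∣h
    ...   | inj₂ (zero , refl , _)    = 1 , ≤-refl , inj₁ (singleBox stop)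
    ...   | inj₂ (suc g , refl , 2∣g) = 1 , ≤-refl , oddRun g run stop 2∣g

  -- Inequality (A).  A maximal row run 1, …, r + 1 shortens by one under Δ,
  -- so by induction Δ^m(s) is a derangement tableau for some m ≤ r + 1.
  rowRun-bound : ∀ r s → IsStandard s → 1 ≤ size s → RowRun s r → RowStop s r → DerangedWithin (suc r) s
  rowRun-bound zero    s S 1≤n _   stop = ShortRow.bound S 1≤n stop
  rowRun-bound (suc r) s S 1≤n run stop
    with rowRun-bound r (Δ s) standard (≤-trans (s≤s z≤n) r<) (rowRun-Δ r run r<) (rowStop-Δ r run stop)
    where
    open Standard S
    open DeltaFacts (deltaFacts s S 1≤n)
    open RunsUnderΔ S 1≤n
    r< : suc r ≤ size (Δ s)
    r< = subst (suc r ≤_) (sym size-Δ) (∸-monoˡ-≤ 1 (proj₂ (range (run (suc r) ≤-refl))))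
  ... | m , m≤ , deranged = suc m , s≤s m≤ , subst IsDerangement (iter-shift m Δ s) deranged

  type+row≤size : ∀ {t J} (S : IsStandard t) (1≤n : 1 ≤ size t) → IsType t J →
                  J + DeltaFacts.i (deltaFacts t S 1≤n) ≤ size t
  type+row≤size {t} {J} S 1≤n type with Runs.maximalRowRun S 1≤n
  ... | r , run , runStops = begin
      J + i          ≤⟨ +-monoˡ-≤ i J≤1+r ⟩
      suc r + i      ≡⟨ cong (_+ i) (+-comm 1 r) ⟩
      r + 1 + i      ≤⟨ bottomRow-size t r i j (IsStandard.rowsNonempty S) (run r ≤-refl) (proj₂ removedBox) ⟩
      size t         ∎
    where
    open DeltaFacts (deltaFacts t S 1≤n)
    open ≤-Reasoning
    J≤1+r : J ≤ suc r
    J≤1+r = type≤ type (rowRun-bound r t S 1≤n run runStops)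

  positivity : ∀ n k i j → k + i ≤ n → ℤ.+ 0 ℤ.< ℤ.+ n ℤ.+ ℤ.+ 2 ℤ.- ℤ.+ k ℤ.+ (ℤ.+ j ℤ.- ℤ.+ i)
  positivity n k i j k+i≤n = subst (ℤ.+ 0 ℤ.<_) (sym (trans regroup (trans difference (ℤ.⊖-≥ (<⇒≤ k+i<)))))
                               (ℤ.+<+ (m<n⇒0<n∸m k+i<))
    where
    k+i< : k + i < n + 2 + j
    k+i< = <-≤-trans (≤-<-trans k+i≤n (m<m+n n (s≤s z≤n))) (m≤m+n (n + 2) j)
    regroup : ℤ.+ n ℤ.+ ℤ.+ 2 ℤ.- ℤ.+ k ℤ.+ (ℤ.+ j ℤ.- ℤ.+ i) ≡ ℤ.+ (n + 2 + j) ℤ.- ℤ.+ (k + i)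
    regroup = rearrange (ℤ.+ n) (ℤ.+ 2) (ℤ.+ k) (ℤ.+ i) (ℤ.+ j)
      where
      rearrange : ∀ (N T K I J : ℤ.ℤ) → N ℤ.+ T ℤ.- K ℤ.+ (J ℤ.- I) ≡ (N ℤ.+ T ℤ.+ J) ℤ.- (K ℤ.+ I)
      rearrange = solve-∀
    difference : ℤ.+ (n + 2 + j) ℤ.- ℤ.+ (k + i) ≡ (n + 2 + j) ℤ.⊖ (k + i)
    difference = ℤ.[+m]-[+n]≡m⊖n (n + 2 + j) (k + i)

open import Defs
open import Data.Nat using (ℕ; _≤_; _<_)
open import Data.Integer using (ℤ; _+_; _-_; +_)
open import Data.Integer using () renaming (_<_ to _<ℤ_)
open import Data.Nat.Properties using (≤-trans; +-monoˡ-≤)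
open import Relation.Binary.PropositionalEquality using (subst; sym)
open Development using (DeltaFacts; deltaFacts; type+row≤size; positivity)

proposition93 : (t : Tableau) → IsStandard t → 1 ≤ size t →
    (k j : ℕ) → IsType t j → k ≤ j →
    + 0 <ℤ (+ size t + + 2 - + k + diagRemoved t)
proposition93 t S 1≤n k J type k≤J =
  subst (λ d → + 0 <ℤ (+ size t + + 2 - + k + d)) (sym diag)
    (positivity (size t) k i j (≤-trans (+-monoˡ-≤ i k≤J) (type+row≤size S 1≤n type)))
  where open DeltaFacts (deltaFacts t S 1≤n)
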